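{- Let $\Sigma$ be a monoidal signature. There exists a translation $\Lambda$ assigning to each GCQ term $c$ of sort $(n,m)$ over $\Sigma$ a CCQ formula $\Lambda(c)$ whose free variables are among $x_0,\dots,x_{n-1},y_0,\dots,y_{m-1}$, over the CCQ signature in which each $R\in\Sigma_{n,m}$ is a relation symbol of arity $n+m$, which is semantics preserving — for every GCQ model $\mathcal M=(X,\rho)$ and all $\vec v\in X^n,\vec w\in X^m$, $(\vec v,\vec w)\in[\![c]\!]_{\mathcal M}$ iff the assignment $x_i\mapsto v_i$, $y_j\mapsto w_j$ satisfies $\Lambda(c)$ in the CCQ model $\Lambda(\mathcal M)=(X,\rho')$ with $\rho'(R)=\rho(R)\subseteq X^{n+m}$ — and such that for all GCQ terms $c,d$ of sort $(n,m)$: $c\leqq d$ iff $\Lambda(c)\leqq_{CCQ}\Lambda(d)$.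
   Context: A monoidal signature $\Sigma$ is a set of symbols each with an arity $n$ and coarity $m$ ($\Sigma_{n,m}$). GCQ terms and sorts: constants $\delta:(1,2)$, $\varepsilon:(1,0)$, $\mu:(2,1)$, $\eta:(0,1)$, $\mathrm{id}_0:(0,0)$, $\mathrm{id}_1:(1,1)$, $\sigma:(2,2)$, each $R\in\Sigma_{n,m}$ of sort $(n,m)$; $c;d:(n,m)$ for $c:(n,z),d:(z,m)$; $c\oplus d:(n+p,m+q)$ for $c:(n,m),d:(p,q)$. A GCQ model $\mathcal M=(X,\rho)$ is a set $X$ with $\rho(R)\subseteq X^n\times X^m$ for $R\in\Sigma_{n,m}$. Semantics $[\![c]\!]_{\mathcal M}\subseteq X^n\times X^m$: $[\![\delta]\!]=\{(x,(x,x))\}$, $[\![\varepsilon]\!]=\{(x,\bullet)\}$, $[\![\mu]\!]=\{((x,x),x)\}$, $[\![\eta]\!]=\{(\bullet,x)\}$, $[\![\mathrm{id}_0]\!]=\{(\bullet,\bullet)\}$, $[\![\mathrm{id}_1]\!]=\{(x,x)\}$, $[\![\sigma]\!]=\{((x,y),(y,x))\}$, $[\![R]\!]=\rho(R)$, $[\![c;d]\!]$ the relational composite, $[\![c\oplus d]\!]=\{((a,u),(b,v))\mid(a,b)\in[\![c]\!],(u,v)\in[\![d]\!]\}$ ($\bullet$ the unique element of $X^0$). GCQ inclusion $c\leqq d$: $[\![c]\!]_{\mathcal M}\subseteq[\![d]\!]_{\mathcal M}$ for all models $\mathcal M$. CCQ formulas over a signature of relation symbols with arities are built from $\top$, atoms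 $R(v_1,\dots,v_k)$ ($k$ the arity of $R$), equalities $v=w$, conjunction $\wedge$ and existential quantification $\exists v$, over variables; a CCQ model is a set $X$ with $\rho'(R)\subseteq X^k$, and satisfaction of a formula by an assignment of its free variables is the usual first-order one. CCQ inclusion $\phi\leqq_{CCQ}\psi$ (for formulas with free variables in a common finite set) means that in every CCQ model every assignment of these variables satisfying $\phi$ satisfies $\psi$. -}

module Defs where

open import Data.Nat using (ℕ; zero; suc; _+_)
open import Data.Fin using (Fin)
open import Data.Vec using (Vec; []; _∷_; take; drop; lookup; map)
open import Data.Product using (Σ; _×_; _,_)
open import Data.Unit using (⊤)
open import Relation.Binary.PropositionalEquality using (_≡_)

MonoidalSignature : Set₁
MonoidalSignature = ℕ → ℕ → Set

data Term (Sig : MonoidalSignature) : ℕ → ℕ → Set where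
  δ    : Term Sig 1 2
  ε    : Term Sig 1 0
  μ    : Term Sig 2 1
  η    : Term Sig 0 1
  id₀  : Term Sig 0 0
  id₁  : Term Sig 1 1
  σ    : Term Sig 2 2
  sym  : ∀ {n m} → Sig n m → Term Sig n m
  _⨾_  : ∀ {n z m} → Term Sig n z → Term Sig z m → Term Sig n m
  _⊕_  : ∀ {n m p q} → Term Sig n m → Term Sig p q → Term Sig (n + p) (m + q)

record GCQModel (Sig : MonoidalSignature) : Set₁ where
  field
    Carrier : Set
    ρ       : ∀ {n m} → Sig n m → Vec Carrier n → Vec Carrier m → Set
open GCQModel public

⟦_⟧ : ∀ {Sig n m} → Term Sig n m → (M : GCQModel Sig) →
      Vec (Carrier M) n → Vec (Carrier M) m → Set
⟦ δ ⟧ M (x ∷ []) (y ∷ z ∷ []) = (x ≡ y) × (x ≡ z)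
⟦ ε ⟧ M (x ∷ []) [] = ⊤
⟦ μ ⟧ M (x ∷ y ∷ []) (z ∷ []) = (x ≡ z) × (y ≡ z)
⟦ η ⟧ M [] (x ∷ []) = ⊤
⟦ id₀ ⟧ M [] [] = ⊤
⟦ id₁ ⟧ M (x ∷ []) (y ∷ []) = x ≡ y
⟦ σ ⟧ M (x ∷ y ∷ []) (y' ∷ x' ∷ []) = (x ≡ x') × (y ≡ y')
⟦ sym R ⟧ M v w = ρ M R v w
⟦ _⨾_ {z = z} c d ⟧ M v w = Σ (Vec (Carrier M) z) λ u → ⟦ c ⟧ M v u × ⟦ d ⟧ M u w
⟦ _⊕_ {n} {m} c d ⟧ M a b =
  ⟦ c ⟧ M (take n a) (take m b) × ⟦ d ⟧ M (drop n a) (drop m b)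

_≦_ : ∀ {Sig n m} → Term Sig n m → Term Sig n m → Set₁
_≦_ {Sig} {n} {m} c d =
  (M : GCQModel Sig) (v : Vec (Carrier M) n) (w : Vec (Carrier M) m) →
  ⟦ c ⟧ M v w → ⟦ d ⟧ M v w

record RelSignature : Set₁ where
  field
    Symbol : Set
    arity  : Symbol → ℕ
open RelSignature public

-- CCQ formulas whose free variables are among k variables (well-scoped,
-- de Bruijn style: variable 0 is the most recently bound one)
data Formula (S : RelSignature) (k : ℕ) : Set where
  ⊤'   : Formula S k
  atom : (R : Symbol S) → Vec (Fin k) (arity S R) → Formula S k
  _≐_  : Fin k → Fin k → Formula S k
  _∧'_ : Formula S k → Formula S k → Formula S k
  ∃'   : Formula S (suc k) → Formula S k

record CCQModel (S : RelSignature) : Set₁ where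
  field
    Carrier' : Set
    ρ'       : (R : Symbol S) → Vec Carrier' (arity S R) → Set
open CCQModel public

Sat : ∀ {S k} (M : CCQModel S) → Formula S k → Vec (Carrier' M) k → Set
Sat M ⊤' env = ⊤
Sat M (atom R args) env = ρ' M R (map (λ i → lookup env i) args)
Sat M (i ≐ j) env = lookup env i ≡ lookup env j
Sat M (φ ∧' ψ) env = Sat M φ env × Sat M ψ env
Sat M (∃' φ) env = Σ (Carrier' M) λ x → Sat M φ (x ∷ env)

_≦CCQ_ : ∀ {S k} → Formula S k → Formula S k → Set₁
_≦CCQ_ {S} {k} φ ψ =
  (M : CCQModel S) (env : Vec (Carrier' M) k) → Sat M φ env → Sat M ψ env

CCQSig : MonoidalSignature → RelSignature
CCQSig Sig = record
  { Symbol = Σ ℕ λ n → Σ ℕ λ m → Sig n m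
  ; arity  = λ { (n , m , _) → n + m } }

toCCQModel : ∀ {Sig} → GCQModel Sig → CCQModel (CCQSig Sig)
toCCQModel M = record
  { Carrier' = Carrier M
  ; ρ' = λ { (n , m , R) v → ρ M R (take n v) (drop n v) } }

module Submission where

-- Generators are
-- read off their relational semantics (equalities between variables, or ⊤),
-- a symbol R becomes the atom R applied to all n + m variables, and the two
-- ways of combining terms are wired up by renaming variables: c ⊕ d is the
-- conjunction of Λ c and Λ d renamed apart, and c ⨾ d additionally hides the
-- z middle variables under a block of existential quantifiers.
--
-- For the
-- inclusion statement, one direction is immediate from sem; for the other,
-- every CCQ model N is turned into a GCQ model fromCCQModel N whose
-- translation interprets the symbols as N does, so sem applies to it too.

open import Defs
open import Data.Nat using (ℕ; zero; suc; _+_)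
open import Data.Fin using (Fin; _↑ˡ_; _↑ʳ_; splitAt; #_) renaming (zero to fzero; suc to fsuc)
open import Data.Vec using (Vec; []; _∷_; _++_; take; drop; lookup; map; allFin)
  renaming (splitAt to splitVec)
open import Data.Vec.Properties
  using (lookup-++ˡ; lookup-++ʳ; lookup-splitAt; map-lookup-allFin; map-∘; map-cong; take++drop≡id)
open import Data.Sum using (inj₁; inj₂; [_,_]′)
open import Data.Product using (Σ; _×_; _,_)
open import Data.Product.Function.NonDependent.Propositional using (_×-⇔_)
open import Data.Product.Function.Dependent.Propositional using (congˡ)
open import Function using (_∘_)
open import Function.Bundles using (_⇔_; mk⇔; Equivalence)
open import Function.Construct.Identity using (⇔-id)
open import Function.Construct.Symmetry using (⇔-sym)
open import Function.Construct.Composition using (_⇔-∘_)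
open import Function.Related.Propositional using (module EquationalReasoning)
open import Relation.Binary.PropositionalEquality using (_≡_; refl; trans; cong; subst) renaming (sym to ≡-sym)

open Equivalence

private
  variable
    A : Set
    S : RelSignature
    k k' n m : ℕ

-- `Along f env env'`: the assignment env' is env read along the renaming f.
-- (A record, so that the renaming and both assignments can be inferred.)
record Along (f : Fin k → Fin k') (env : Vec A k') (env' : Vec A k) : Set where
  constructor along
  field read : ∀ i → lookup env (f i) ≡ lookup env' i
open Along

along-↑ˡ : (xs : Vec A n) (ys : Vec A m) → Along (_↑ˡ m) (xs ++ ys) xs
along-↑ˡ xs ys = along (lookup-++ˡ xs ys)

along-↑ʳ : (xs : Vec A n) (ys : Vec A m) → Along (n ↑ʳ_) (xs ++ ys) ys
along-↑ʳ xs ys = along (lookup-++ʳ xs ys)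

along-∘ : ∀ {j} {f : Fin k → Fin k'} {g : Fin j → Fin k}
  {env : Vec A k'} {env' : Vec A k} {env'' : Vec A j} →
  Along f env env' → Along g env' env'' → Along (f ∘ g) env env''
along-∘ {g = g} p q = along λ i → trans (read p (g i)) (read q i)

[_∣_] : (Fin n → Fin k) → (Fin m → Fin k) → Fin (n + m) → Fin k
[_∣_] {n = n} g h i = [ g , h ]′ (splitAt n i)

along-[∣] : ∀ {g : Fin n → Fin k} {h : Fin m → Fin k} {env : Vec A k} {xs ys} →
  Along g env xs → Along h env ys → Along [ g ∣ h ] env (xs ++ ys)
along-[∣] {n = n} {g = g} {h} {env} {xs} {ys} p q =
  along λ i → trans (onSplit (splitAt n i)) (≡-sym (lookup-splitAt n xs ys i))
  where
  onSplit : ∀ s → lookup env ([ g , h ]′ s) ≡ [ lookup xs , lookup ys ]′ s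
  onSplit (inj₁ a) = read p a
  onSplit (inj₂ b) = read q b

extend : (Fin k → Fin k') → Fin (suc k) → Fin (suc k')
extend f fzero = fzero
extend f (fsuc i) = fsuc (f i)

along-extend : ∀ {f : Fin k → Fin k'} {env env'} (x : A) →
  Along f env env' → Along (extend f) (x ∷ env) (x ∷ env')
along-extend x p = along λ
  { fzero → refl
  ; (fsuc i) → read p i }

rename : (Fin k → Fin k') → Formula S k → Formula S k'
rename f ⊤' = ⊤'
rename f (atom R args) = atom R (map f args)
rename f (i ≐ j) = f i ≐ f j
rename f (φ ∧' ψ) = rename f φ ∧' rename f ψ
rename f (∃' φ) = ∃' (rename (extend f) φ)

Sat-rename : (M : CCQModel S) {f : Fin k → Fin k'} (φ : Formula S k)
  {env : Vec (Carrier' M) k'} {env' : Vec (Carrier' M) k} →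
  Along f env env' → Sat M (rename f φ) env ⇔ Sat M φ env'
Sat-rename M ⊤' p = ⇔-id _
Sat-rename M {f} (atom R args) {env} {env'} p =
  mk⇔ (subst (ρ' M R) readArgs) (subst (ρ' M R) (≡-sym readArgs))
  where
  readArgs : map (lookup env) (map f args) ≡ map (lookup env') args
  readArgs = trans (≡-sym (map-∘ (lookup env) f args)) (map-cong (read p) args)
Sat-rename M (i ≐ j) p =
  mk⇔ (λ e → trans (≡-sym (read p i)) (trans e (read p j)))
      (λ e → trans (read p i) (trans e (≡-sym (read p j))))
Sat-rename M (φ ∧' ψ) p = Sat-rename M φ p ×-⇔ Sat-rename M ψ p
Sat-rename M (∃' φ) p = congˡ (λ {x} → Sat-rename M φ (along-extend x p))

∃* : ∀ z → Formula S (z + k) → Formula S k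
∃* zero φ = φ
∃* (suc z) φ = ∃* z (∃' φ)

Sat-∃* : ∀ z (M : CCQModel S) (φ : Formula S (z + k)) (env : Vec (Carrier' M) k) →
  Sat M (∃* z φ) env ⇔ Σ (Vec (Carrier' M) z) λ u → Sat M φ (u ++ env)
Sat-∃* zero M φ env = mk⇔ (λ s → [] , s) (λ { ([] , s) → s })
Sat-∃* (suc z) M φ env =
  mk⇔ (λ s → let (u , x , t) = to (Sat-∃* z M (∃' φ) env) s in x ∷ u , t)
      (λ { (x ∷ u , t) → from (Sat-∃* z M (∃' φ) env) (u , x , t) })

Sat-resp : (N : CCQModel S) (ρ₂ : (R : Symbol S) → Vec (Carrier' N) (arity S R) → Set) →
  (∀ R u → ρ' N R u ⇔ ρ₂ R u) → (φ : Formula S k) (env : Vec (Carrier' N) k) →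
  Sat N φ env ⇔ Sat (record { Carrier' = Carrier' N ; ρ' = ρ₂ }) φ env
Sat-resp N ρ₂ h ⊤' env = ⇔-id _
Sat-resp N ρ₂ h (atom R args) env = h R _
Sat-resp N ρ₂ h (i ≐ j) env = ⇔-id _
Sat-resp N ρ₂ h (φ ∧' ψ) env = Sat-resp N ρ₂ h φ env ×-⇔ Sat-resp N ρ₂ h ψ env
Sat-resp N ρ₂ h (∃' φ) env = congˡ (λ {x} → Sat-resp N ρ₂ h φ (x ∷ env))

take-++ : (v : Vec A n) (w : Vec A m) → take n (v ++ w) ≡ v
take-++ [] w = refl
take-++ (x ∷ v) w = cong (x ∷_) (take-++ v w)

drop-++ : (v : Vec A n) (w : Vec A m) → drop n (v ++ w) ≡ w
drop-++ [] w = refl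
drop-++ (x ∷ v) w = drop-++ v w

module Translation (Sig : MonoidalSignature) where

  -- Wiring of c ⊕ d, over variables (a₁ ++ a₂) ++ (b₁ ++ b₂):
  -- Λ c sees a₁ ++ b₁ and Λ d sees a₂ ++ b₂.
  parˡ : ∀ n m p q → Fin (n + m) → Fin ((n + p) + (m + q))
  parˡ n m p q = [ (_↑ˡ (m + q)) ∘ (_↑ˡ p) ∣ ((n + p) ↑ʳ_) ∘ (_↑ˡ q) ]

  parʳ : ∀ n m p q → Fin (p + q) → Fin ((n + p) + (m + q))
  parʳ n m p q = [ (_↑ˡ (m + q)) ∘ (n ↑ʳ_) ∣ ((n + p) ↑ʳ_) ∘ (m ↑ʳ_) ]

  -- Wiring of c ⨾ d, over variables u ++ (v ++ w) with u the z hidden ones: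
  -- Λ c sees v ++ u and Λ d sees u ++ w.
  seqˡ : ∀ n z m → Fin (n + z) → Fin (z + (n + m))
  seqˡ n z m = [ (z ↑ʳ_) ∘ (_↑ˡ m) ∣ (_↑ˡ (n + m)) ]

  seqʳ : ∀ n z m → Fin (z + m) → Fin (z + (n + m))
  seqʳ n z m = [ (_↑ˡ (n + m)) ∣ (z ↑ʳ_) ∘ (n ↑ʳ_) ]

  -- The translation; variable i < n is the input xᵢ, variable n + j the output yⱼ.
  Λ : Term Sig n m → Formula (CCQSig Sig) (n + m)
  Λ δ = ((# 0) ≐ (# 1)) ∧' ((# 0) ≐ (# 2))
  Λ ε = ⊤'
  Λ μ = ((# 0) ≐ (# 2)) ∧' ((# 1) ≐ (# 2))
  Λ η = ⊤'
  Λ id₀ = ⊤'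
  Λ id₁ = (# 0) ≐ (# 1)
  Λ σ = ((# 0) ≐ (# 3)) ∧' ((# 1) ≐ (# 2))
  Λ (sym {n} {m} R) = atom (n , m , R) (allFin (n + m))
  Λ (_⨾_ {n} {z} {m} c d) = ∃* z (rename (seqˡ n z m) (Λ c) ∧' rename (seqʳ n z m) (Λ d))
  Λ (_⊕_ {n} {m} {p} {q} c d) = rename (parˡ n m p q) (Λ c) ∧' rename (parʳ n m p q) (Λ d)

  sem : (c : Term Sig n m) (M : GCQModel Sig) (v : Vec (Carrier M) n) (w : Vec (Carrier M) m) →
    ⟦ c ⟧ M v w ⇔ Sat (toCCQModel M) (Λ c) (v ++ w)
  sem δ M (x ∷ []) (y ∷ z ∷ []) = ⇔-id _
  sem ε M (x ∷ []) [] = ⇔-id _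
  sem μ M (x ∷ y ∷ []) (z ∷ []) = ⇔-id _
  sem η M [] (x ∷ []) = ⇔-id _
  sem id₀ M [] [] = ⇔-id _
  sem id₁ M (x ∷ []) (y ∷ []) = ⇔-id _
  sem σ M (x ∷ y ∷ []) (y' ∷ x' ∷ []) = ⇔-id _
  -- An atom reads its arguments back as v ++ w, which ρ' splits into v and w.
  sem (sym R) M v w
    rewrite map-lookup-allFin (v ++ w) | take-++ v w | drop-++ v w = ⇔-id _
  sem (_⨾_ {n} {z} {m} c d) M v w = begin
    (Σ (Vec X z) λ u → ⟦ c ⟧ M v u × ⟦ d ⟧ M u w)
      ∼⟨ congˡ (λ {u} → sem c M v u ×-⇔ sem d M u w) ⟩
    (Σ (Vec X z) λ u → Sat N (Λ c) (v ++ u) × Sat N (Λ d) (u ++ w))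
      ∼⟨ ⇔-sym (congˡ (λ {u} → Sat-rename N (Λ c) (wireˡ u) ×-⇔ Sat-rename N (Λ d) (wireʳ u))) ⟩
    (Σ (Vec X z) λ u → Sat N φ (u ++ (v ++ w)))
      ∼⟨ ⇔-sym (Sat-∃* z N φ (v ++ w)) ⟩
    Sat N (∃* z φ) (v ++ w) ∎
    where
    open EquationalReasoning
    X = Carrier M
    N = toCCQModel M
    φ = rename (seqˡ n z m) (Λ c) ∧' rename (seqʳ n z m) (Λ d)
    wireˡ : ∀ u → Along (seqˡ n z m) (u ++ (v ++ w)) (v ++ u)
    wireˡ u = along-[∣] (along-∘ (along-↑ʳ u (v ++ w)) (along-↑ˡ v w)) (along-↑ˡ u (v ++ w))
    wireʳ : ∀ u → Along (seqʳ n z m) (u ++ (v ++ w)) (u ++ w)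
    wireʳ u = along-[∣] (along-↑ˡ u (v ++ w)) (along-∘ (along-↑ʳ u (v ++ w)) (along-↑ʳ v w))
  -- Splitting inputs and outputs at n and m makes ⟦ c ⊕ d ⟧ a product.
  sem (_⊕_ {n} {m} {p} {q} c d) M a b
    with splitVec n a | splitVec m b
  ... | a₁ , a₂ , refl | b₁ , b₂ , refl = begin
    (⟦ c ⟧ M a₁ b₁ × ⟦ d ⟧ M a₂ b₂)
      ∼⟨ sem c M a₁ b₁ ×-⇔ sem d M a₂ b₂ ⟩
    (Sat N (Λ c) (a₁ ++ b₁) × Sat N (Λ d) (a₂ ++ b₂))
      ∼⟨ ⇔-sym (Sat-rename N (Λ c) wireˡ ×-⇔ Sat-rename N (Λ d) wireʳ) ⟩
    Sat N (Λ (c ⊕ d)) ((a₁ ++ a₂) ++ (b₁ ++ b₂)) ∎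
    where
    open EquationalReasoning
    N = toCCQModel M
    env = (a₁ ++ a₂) ++ (b₁ ++ b₂)
    wireˡ : Along (parˡ n m p q) env (a₁ ++ b₁)
    wireˡ = along-[∣] (along-∘ (along-↑ˡ (a₁ ++ a₂) (b₁ ++ b₂)) (along-↑ˡ a₁ a₂))
                      (along-∘ (along-↑ʳ (a₁ ++ a₂) (b₁ ++ b₂)) (along-↑ˡ b₁ b₂))
    wireʳ : Along (parʳ n m p q) env (a₂ ++ b₂)
    wireʳ = along-[∣] (along-∘ (along-↑ˡ (a₁ ++ a₂) (b₁ ++ b₂)) (along-↑ʳ a₁ a₂))
                      (along-∘ (along-↑ʳ (a₁ ++ a₂) (b₁ ++ b₂)) (along-↑ʳ b₁ b₂))

  -- Every CCQ model is, up to equivalence of interpretations, the translation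
  -- of a GCQ model: R ∈ Sig n m relates v to w when ρ'(R) holds of v ++ w.
  fromCCQModel : CCQModel (CCQSig Sig) → GCQModel Sig
  fromCCQModel N = record
    { Carrier = Carrier' N
    ; ρ = λ {n} {m} R v w → ρ' N (n , m , R) (v ++ w) }

  Sat-roundTrip : (N : CCQModel (CCQSig Sig)) (φ : Formula (CCQSig Sig) k)
    (env : Vec (Carrier' N) k) → Sat N φ env ⇔ Sat (toCCQModel (fromCCQModel N)) φ env
  Sat-roundTrip N = Sat-resp N (ρ' (toCCQModel (fromCCQModel N))) resplit
    where
    resplit : ∀ R u → ρ' N R u ⇔ ρ' (toCCQModel (fromCCQModel N)) R u
    resplit (n , m , R) u = mk⇔ (subst (ρ' N (n , m , R)) (≡-sym (take++drop≡id n u)))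
                                (subst (ρ' N (n , m , R)) (take++drop≡id n u))

  sem-fromCCQ : (c : Term Sig n m) (N : CCQModel (CCQSig Sig))
    (v : Vec (Carrier' N) n) (w : Vec (Carrier' N) m) →
    ⟦ c ⟧ (fromCCQModel N) v w ⇔ Sat N (Λ c) (v ++ w)
  sem-fromCCQ c N v w = ⇔-sym (Sat-roundTrip N (Λ c) (v ++ w)) ⇔-∘ sem c (fromCCQModel N) v w

  inclusion : (c d : Term Sig n m) → (c ≦ d) ⇔ (Λ c ≦CCQ Λ d)
  inclusion {n} c d = mk⇔ preserve reflect
    where
    preserve : c ≦ d → Λ c ≦CCQ Λ d
    -- every assignment of the n + m variables has the form v ++ w
    preserve c≦d N env with splitVec n env
    ... | v , w , refl = to (sem-fromCCQ d N v w) ∘ c≦d (fromCCQModel N) v w ∘ from (sem-fromCCQ c N v w)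
    reflect : Λ c ≦CCQ Λ d → c ≦ d
    reflect Λc≦Λd M v w = from (sem d M v w) ∘ Λc≦Λd (toCCQModel M) (v ++ w) ∘ to (sem c M v w)

open Translation

mainTheorem14 : (Sig : MonoidalSignature) →
    Σ (∀ {n m} → Term Sig n m → Formula (CCQSig Sig) (n + m)) λ Λ →
      (∀ {n m} (c : Term Sig n m) (M : GCQModel Sig)
         (v : Vec (Carrier M) n) (w : Vec (Carrier M) m) →
         ⟦ c ⟧ M v w ⇔ Sat (toCCQModel M) (Λ c) (v ++ w))
      × (∀ {n m} (c d : Term Sig n m) → (c ≦ d) ⇔ (Λ c ≦CCQ Λ d))
mainTheorem14 Sig = Λ Sig , sem Sig , inclusion Sig
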